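{- Let $K$ be a complete discretely valued field with ring of integers $\mathcal{O}_K$ and uniformiser $\pi$, and let $\rho\colon G\to\mathrm{GL}(V)$ be a representation of a group $G$ on a finite-dimensional $K$-vector space $V$ admitting at least one $\rho(G)$-stable lattice. If $S\subseteq\mathcal{X}(\rho)$ is a subset whose tropical convex hull is $\mathcal{X}(\rho)$, then $\mathcal{X}_{\max}(\rho)\subseteq S$.
   Context: A lattice is a free $\mathcal{O}_K$-submodule of $V$ of rank $\dim_KV$, $\rho(G)$-stable if $\rho(g)\Lambda=\Lambda$ for all $g$. $\mathcal{X}(V)$ is the set of homothety classes of lattices and $\mathcal{X}(\rho)$ the set of classes of stable lattices. A set of classes is tropically convex if for any two lattices $\Lambda_1,\Lambda_2$ representing classes in it, the class of $\Lambda_1\cap\Lambda_2$ also lies in it; the tropical convex hull of $S$ is the intersection of all tropically convex subsets of $\mathcal{X}(V)$ containing $S$ (equivalently, the set of classes of finite intersections of lattices representing classes in $S$). A stable lattice $\Lambda$ is normalised at a nonzero $v\in V$ if $v\in\Lambda$ and its image in $\Lambda/\pi\Lambda$ is nonzero; it is maximal with respect to $v$ if maximal under inclusion among stable lattices normalised at $v$; maximal if maximal with respect to some nonzero $v$. $\mathcal{X}_{\max}(\rho)$ is the set of classes of maximal stable lattices. -}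

module Defs where

open import Level using (0ℓ)
open import Data.Nat using (ℕ) renaming (_≤_ to _≤ℕ_)
open import Data.Integer using (ℤ; +_) renaming (_+_ to _+ℤ_; _≤_ to _≤ℤ_)
open import Data.Maybe using (Maybe; just; nothing)
open import Data.Fin using (Fin; zero; suc)
open import Data.Product using (Σ; ∃; _×_; _,_)
open import Data.Empty using (⊥)
open import Function using (_∘_)
open import Relation.Nullary using (¬_)
open import Relation.Binary.PropositionalEquality using (_≡_; _≢_)
open import Algebra.Structures using (IsCommutativeRing; IsAbelianGroup)
open import Algebra.Bundles using (Group)

-- Extended integers ℤ ∪ {∞}, encoded as Maybe ℤ (nothing = ∞)

ℤ∞ : Set
ℤ∞ = Maybe ℤ

_+∞_ : ℤ∞ → ℤ∞ → ℤ∞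
just a +∞ just b = just (a +ℤ b)
_      +∞ _      = nothing

_≥∞_ : ℤ∞ → ℤ → Set
nothing ≥∞ N = Data.Unit.⊤ where import Data.Unit
just a  ≥∞ N = N ≤ℤ a

record CDVField : Set₁ where
  field
    K      : Set
    0# 1#  : K
    _+_ _*_ : K → K → K
    -_     : K → K
    isCommutativeRing : IsCommutativeRing _≡_ _+_ _*_ -_ 0# 1#
    0≢1    : 0# ≢ 1#
    inverse : ∀ x → x ≢ 0# → ∃ λ y → x * y ≡ 1#
    v      : K → ℤ∞
    v-∞⇒0  : ∀ x → v x ≡ nothing → x ≡ 0#
    v-0    : v 0# ≡ nothing
    v-*    : ∀ x y → v (x * y) ≡ v x +∞ v y
    v-+    : ∀ x y N → v x ≥∞ N → v y ≥∞ N → v (x + y) ≥∞ N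
    -- uniformiser (so the value group is all of ℤ: the valuation is discrete, normalised)
    π      : K
    v-π    : v π ≡ just (+ 1)
    complete : (s : ℕ → K) →
               (∀ (N : ℤ) → ∃ λ M → ∀ m n → M ≤ℕ m → M ≤ℕ n → v (s m + (- s n)) ≥∞ N) →
               ∃ λ L → ∀ (N : ℤ) → ∃ λ M → ∀ m → M ≤ℕ m → v (s m + (- L)) ≥∞ N

  InO : K → Set
  InO x = v x ≥∞ (+ 0)

linComb : ∀ {S V : Set} → V → (V → V → V) → (S → V → V) → ∀ {n} → (Fin n → S) → (Fin n → V) → V
linComb z _⊕_ _⊙_ {ℕ.zero}  a e = z
linComb z _⊕_ _⊙_ {ℕ.suc n} a e = (a zero ⊙ e zero) ⊕ linComb z _⊕_ _⊙_ (a ∘ suc) (e ∘ suc)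

module _ (F : CDVField) where
  open CDVField F

  record FDVS : Set₁ where
    field
      V    : Set
      0ᵥ   : V
      _+ᵥ_ : V → V → V
      -ᵥ_  : V → V
      _·_  : K → V → V
      isAbelianGroup : IsAbelianGroup _≡_ _+ᵥ_ 0ᵥ -ᵥ_
      ·-distribˡ : ∀ a x y → a · (x +ᵥ y) ≡ (a · x) +ᵥ (a · y)
      ·-distribʳ : ∀ a b x → (a + b) · x ≡ (a · x) +ᵥ (b · x)
      ·-assoc    : ∀ a b x → (a * b) · x ≡ a · (b · x)
      ·-identity : ∀ x → 1# · x ≡ x

    field
      dim   : ℕ
      basis : Fin dim → V
      basis-spans : ∀ x → ∃ λ (a : Fin dim → K) → x ≡ linComb 0ᵥ _+ᵥ_ _·_ a basis
      basis-indep : ∀ (a : Fin dim → K) → linComb 0ᵥ _+ᵥ_ _·_ a basis ≡ 0ᵥ → ∀ i → a i ≡ 0#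

    lc : ∀ {n} → (Fin n → K) → (Fin n → V) → V
    lc = linComb 0ᵥ _+ᵥ_ _·_

module Lattices (F : CDVField) (W : FDVS F) where
  open CDVField F
  open FDVS W

  SubV : Set₁
  SubV = V → Set

  _⊆_ : SubV → SubV → Set
  Λ ⊆ Λ' = ∀ x → Λ x → Λ' x

  _∩_ : SubV → SubV → SubV
  (Λ ∩ Λ') x = Λ x × Λ' x

  scale : K → SubV → SubV
  scale c Λ x = ∃ λ y → Λ y × x ≡ c · y

  IsLattice : SubV → Set
  IsLattice Λ = ∃ λ (e : Fin dim → V) →
      (∀ x → Λ x → ∃ λ (a : Fin dim → K) → (∀ i → InO (a i)) × x ≡ lc a e)
    × (∀ (a : Fin dim → K) → (∀ i → InO (a i)) → Λ (lc a e))
    × (∀ (a : Fin dim → K) → (∀ i → InO (a i)) → lc a e ≡ 0ᵥ → ∀ i → a i ≡ 0#)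

  Homothetic : SubV → SubV → Set
  Homothetic Λ Λ' = ∃ λ c → c ≢ 0# × (Λ' ⊆ scale c Λ) × (scale c Λ ⊆ Λ')

  -- A set of homothety classes of lattices, represented as a predicate on lattices
  -- that is closed under homothety (membership of the class [Λ] ↔ A Λ).
  ClassSet : (SubV → Set) → Set₁
  ClassSet A = ∀ Λ Λ' → IsLattice Λ → Homothetic Λ Λ' → A Λ → A Λ'

  TropicallyConvex : (SubV → Set) → Set₁
  TropicallyConvex A = ∀ Λ₁ Λ₂ → IsLattice Λ₁ → IsLattice Λ₂ → A Λ₁ → A Λ₂ → A (Λ₁ ∩ Λ₂)

  InHull : (SubV → Set) → SubV → Set₁
  InHull S Λ = ∀ (A : SubV → Set) → ClassSet A → TropicallyConvex A →
               (∀ Λ' → IsLattice Λ' → S Λ' → A Λ') → A Λ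

  record Rep (G : Group 0ℓ 0ℓ) : Set₁ where
    open Group G renaming (Carrier to |G|; _∙_ to _∙G_; ε to εG)
    field
      ρ        : |G| → V → V
      ρ-+      : ∀ g x y → ρ g (x +ᵥ y) ≡ ρ g x +ᵥ ρ g y
      ρ-·      : ∀ g a x → ρ g (a · x) ≡ a · ρ g x
      ρ-∙      : ∀ g h x → ρ (g ∙G h) x ≡ ρ g (ρ h x)
      ρ-ε      : ∀ x → ρ εG x ≡ x
      ρ-resp   : ∀ g h x → g ≈ h → ρ g x ≡ ρ h x

    Stable : SubV → Set
    Stable Λ = ∀ g → (∀ x → Λ x → Λ (ρ g x)) × (∀ x → Λ x → ∃ λ y → Λ y × ρ g y ≡ x)

    StableLattice : SubV → Set
    StableLattice Λ = IsLattice Λ × Stable Λ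

    -- normalised at w: w ∈ Λ and w ∉ πΛ (image in Λ/πΛ nonzero)
    NormalisedAt : V → SubV → Set
    NormalisedAt w Λ = Λ w × ¬ scale π Λ w

    MaximalWrt : V → SubV → Set₁
    MaximalWrt w Λ = StableLattice Λ × NormalisedAt w Λ ×
      (∀ Λ' → StableLattice Λ' → NormalisedAt w Λ' → Λ ⊆ Λ' → Λ' ⊆ Λ)

    MaximalStable : SubV → Set₁
    MaximalStable Λ = ∃ λ w → w ≢ 0ᵥ × MaximalWrt w Λ

{-# OPTIONS --safe #-}
-- Fix Λ maximal with respect to w.  Call a class [M] controlled if every representative
-- N ⊇ Λ either satisfies N ⊆ Λ and [N] ∈ S, or is not normalised at w.  By maximality of Λ
-- every class of S is controlled, and controlled classes are tropically convex: if
-- N = c(M₁ ∩ M₂) ⊇ Λ, then either some cMᵢ is squeezed between N and Λ, or w ∈ πcM₁ ∩ πcM₂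
-- = πN.  Hence [Λ] is controlled, and since Λ is normalised at w, [Λ] ∈ S.
module Submission where

open import Defs
open import Level using (0ℓ)
open import Algebra.Bundles using (Group; AbelianGroup; CommutativeRing)
import Algebra.Properties.AbelianGroup as AbelianGroupProperties
import Algebra.Properties.CommutativeSemigroup as CommutativeSemigroupProperties
import Algebra.Properties.Ring as RingProperties
open import Data.Empty using (⊥-elim)
open import Data.Fin using (Fin; zero; suc)
open import Data.Fin.Properties using (all?)
open import Data.Integer using (+_; -[1+_]; +≤+) renaming (_≤?_ to _≤ℤ?_)
import Data.Integer.Properties as ℤ
open import Data.Maybe using (just; nothing)
open import Data.Maybe.Properties using (just-injective)
open import Data.Nat using (ℕ; z≤n)
open import Data.Product using (∃; _×_; _,_; proj₁; proj₂)
open import Data.Sum using (_⊎_; inj₁; inj₂; map₁)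
open import Data.Unit using (tt)
open import Function using (_∘_)
open import Relation.Nullary using (¬_; Dec; yes; no)
open import Relation.Nullary.Decidable using (map′)
open import Relation.Binary.PropositionalEquality
  using (_≡_; _≢_; refl; sym; trans; cong; cong₂; subst; module ≡-Reasoning)

module ℤGroup = AbelianGroupProperties ℤ.+-0-abelianGroup

module FieldFacts (F : CDVField) where
  open CDVField F

  commutativeRing : CommutativeRing 0ℓ 0ℓ
  commutativeRing = record
    { Carrier = K ; _≈_ = _≡_ ; _+_ = _+_ ; _*_ = _*_ ; -_ = -_ ; 0# = 0# ; 1# = 1#
    ; isCommutativeRing = isCommutativeRing }

  open CommutativeRing commutativeRing public
    using (+-identityˡ; *-assoc; *-comm; *-identityˡ; zeroʳ)
  open RingProperties (CommutativeRing.ring commutativeRing)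
    using (-1*x≈-x; -‿involutive)
  open AbelianGroupProperties (CommutativeRing.+-abelianGroup commutativeRing)
    using (//-rightDividesˡ)

  1≢0 : 1# ≢ 0#
  1≢0 = 0≢1 ∘ sym

  π≢0 : π ≢ 0#
  π≢0 π≡0 with trans (sym v-π) (trans (cong v π≡0) v-0)
  ... | ()

  *-nonzero : ∀ {x y} → x ≢ 0# → y ≢ 0# → x * y ≢ 0#
  *-nonzero {x} {y} x≢0 y≢0 xy≡0 with inverse x x≢0
  ... | x⁻¹ , xx⁻¹≡1 = y≢0 (begin
    y              ≡⟨ sym (*-identityˡ y) ⟩
    1# * y         ≡⟨ cong (_* y) (trans (sym xx⁻¹≡1) (*-comm x x⁻¹)) ⟩
    (x⁻¹ * x) * y  ≡⟨ *-assoc x⁻¹ x y ⟩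
    x⁻¹ * (x * y)  ≡⟨ cong (x⁻¹ *_) xy≡0 ⟩
    x⁻¹ * 0#       ≡⟨ zeroʳ x⁻¹ ⟩
    0#             ∎)
    where open ≡-Reasoning

  sub-add-cancel : ∀ x y → (x + (- y)) + y ≡ x
  sub-add-cancel x y = //-rightDividesˡ y x

  v-1 : v 1# ≡ just (+ 0)
  v-1 with v 1# | v-∞⇒0 1# | trans (cong v (sym (*-identityˡ 1#))) (v-* 1# 1#)
  ... | nothing | v1≡∞⇒1≡0 | _     = ⊥-elim (0≢1 (sym (v1≡∞⇒1≡0 refl)))
  ... | just z  | _        | z≡z+z =
    cong just (ℤGroup.identityˡ-unique z z (sym (just-injective z≡z+z)))

  π⁻¹ : K
  π⁻¹ = proj₁ (inverse π π≢0)

  ππ⁻¹≡1 : π * π⁻¹ ≡ 1#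
  ππ⁻¹≡1 = proj₂ (inverse π π≢0)

  v-π⁻¹ : v π⁻¹ ≡ just -[1+ 0 ]
  v-π⁻¹ with v π⁻¹
    | trans (sym (trans (v-* π π⁻¹) (cong (_+∞ v π⁻¹) v-π))) (trans (cong v ππ⁻¹≡1) v-1)
  ... | nothing | ()
  ... | just z  | 1+z≡0 = cong just (ℤGroup.inverseʳ-unique (+ 1) z (just-injective 1+z≡0))

  InO-* : ∀ {x y} → InO x → InO y → InO (x * y)
  InO-* {x} {y} x∈O y∈O rewrite v-* x y with v x | v y
  ... | nothing | _      = tt
  ... | just _  | nothing = tt
  ... | just _  | just _  = ℤ.+-mono-≤ x∈O y∈O

  InO-π : InO π
  InO-π rewrite v-π = +≤+ z≤n

  -- (-1)² = 1 forces v(-1) + v(-1) = 0, impossible when v(-1) < 0.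
  InO--1 : InO (- 1#)
  InO--1 with v (- 1#) | trans (sym (v-* (- 1#) (- 1#))) (trans (cong v square) v-1)
    where square = trans (-1*x≈-x (- 1#)) (-‿involutive 1#)
  ... | nothing      | _  = tt
  ... | just (+ _)   | _  = +≤+ z≤n
  ... | just -[1+ _ ] | ()

  InO-sub : ∀ {x y} → InO x → InO y → InO (x + (- y))
  InO-sub {x} {y} x∈O y∈O =
    v-+ x (- y) (+ 0) x∈O (subst InO (-1*x≈-x y) (InO-* InO--1 y∈O))

  v-π* : ∀ {b} → InO b → v (π * b) ≥∞ (+ 1)
  v-π* {b} b∈O rewrite v-* π b | v-π with v b
  ... | nothing = tt
  ... | just _  = ℤ.+-monoʳ-≤ (+ 1) b∈O

  InO-π⁻¹* : ∀ {a} → v a ≥∞ (+ 1) → InO (π⁻¹ * a)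
  InO-π⁻¹* {a} va≥1 rewrite v-* π⁻¹ a | v-π⁻¹ with v a
  ... | nothing = tt
  ... | just _  = ℤ.+-monoʳ-≤ -[1+ 0 ] va≥1

  π*π⁻¹* : ∀ a → π * (π⁻¹ * a) ≡ a
  π*π⁻¹* a = trans (sym (*-assoc π π⁻¹ a)) (trans (cong (_* a) ππ⁻¹≡1) (*-identityˡ a))

  _≥∞?_ : ∀ m N → Dec (m ≥∞ N)
  nothing ≥∞? N = yes tt
  just z  ≥∞? N = N ≤ℤ? z

module VectorSpaceFacts (F : CDVField) (W : FDVS F) where
  open CDVField F
  open FieldFacts F using (*-comm)
  open FDVS W

  abelianGroupᵥ : AbelianGroup 0ℓ 0ℓ
  abelianGroupᵥ = record
    { Carrier = V ; _≈_ = _≡_ ; _∙_ = _+ᵥ_ ; ε = 0ᵥ ; _⁻¹ = -ᵥ_ ; isAbelianGroup = isAbelianGroup }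

  open AbelianGroupProperties abelianGroupᵥ public using (∙-cancelʳ)
  open AbelianGroupProperties abelianGroupᵥ using (identityˡ-unique)
  open CommutativeSemigroupProperties (AbelianGroup.commutativeSemigroup abelianGroupᵥ)
    using (interchange)
  open AbelianGroup abelianGroupᵥ public using () renaming (identityˡ to +ᵥ-identityˡ)

  ·-zeroʳ : ∀ c → c · 0ᵥ ≡ 0ᵥ
  ·-zeroʳ c = identityˡ-unique (c · 0ᵥ) (c · 0ᵥ)
    (trans (sym (·-distribˡ c 0ᵥ 0ᵥ)) (cong (c ·_) (+ᵥ-identityˡ 0ᵥ)))

  ·-cancelˡ : ∀ {c u u'} → c ≢ 0# → c · u ≡ c · u' → u ≡ u'
  ·-cancelˡ {c} {u} {u'} c≢0 cu≡cu' with inverse c c≢0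
  ... | c⁻¹ , cc⁻¹≡1 = begin
    u                ≡⟨ sym (·-identity u) ⟩
    1# · u           ≡⟨ cong (_· u) c⁻¹c≡1 ⟨
    (c⁻¹ * c) · u    ≡⟨ ·-assoc c⁻¹ c u ⟩
    c⁻¹ · (c · u)    ≡⟨ cong (c⁻¹ ·_) cu≡cu' ⟩
    c⁻¹ · (c · u')   ≡⟨ ·-assoc c⁻¹ c u' ⟨
    (c⁻¹ * c) · u'   ≡⟨ cong (_· u') c⁻¹c≡1 ⟩
    1# · u'          ≡⟨ ·-identity u' ⟩
    u'               ∎
    where
    open ≡-Reasoning
    c⁻¹c≡1 = trans (*-comm c⁻¹ c) cc⁻¹≡1

  lc-cong : ∀ {n} {a b : Fin n → K} (e : Fin n → V) → (∀ i → a i ≡ b i) → lc a e ≡ lc b e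
  lc-cong {ℕ.zero}  e a≗b = refl
  lc-cong {ℕ.suc n} e a≗b = cong₂ _+ᵥ_ (cong (_· e zero) (a≗b zero)) (lc-cong (e ∘ suc) (a≗b ∘ suc))

  lc-+ : ∀ {n} (a b : Fin n → K) (e : Fin n → V) → lc (λ i → a i + b i) e ≡ lc a e +ᵥ lc b e
  lc-+ {ℕ.zero}  a b e = sym (+ᵥ-identityˡ 0ᵥ)
  lc-+ {ℕ.suc n} a b e = trans
    (cong₂ _+ᵥ_ (·-distribʳ (a zero) (b zero) (e zero)) (lc-+ (a ∘ suc) (b ∘ suc) (e ∘ suc)))
    (interchange _ _ _ _)

  ·-lc : ∀ {n} c (a : Fin n → K) (e : Fin n → V) → c · lc a e ≡ lc (λ i → c * a i) e
  ·-lc {ℕ.zero}  c a e = ·-zeroʳ c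
  ·-lc {ℕ.suc n} c a e = trans (·-distribˡ c _ _)
    (cong₂ _+ᵥ_ (sym (·-assoc c (a zero) (e zero))) (·-lc c (a ∘ suc) (e ∘ suc)))

  lc-· : ∀ {n} c (a : Fin n → K) (e : Fin n → V) → lc a (λ i → c · e i) ≡ c · lc a e
  lc-· {ℕ.zero}  c a e = sym (·-zeroʳ c)
  lc-· {ℕ.suc n} c a e = trans
    (cong₂ _+ᵥ_ (·-commute (a zero) (e zero)) (lc-· c (a ∘ suc) (e ∘ suc)))
    (sym (·-distribˡ c _ _))
    where
    ·-commute : ∀ b x → b · (c · x) ≡ c · (b · x)
    ·-commute b x = trans (sym (·-assoc b c x)) (trans (cong (_· x) (*-comm b c)) (·-assoc c b x))

module LatticeFacts (F : CDVField) (W : FDVS F) where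
  open CDVField F
  open FDVS W
  open Lattices F W
  open FieldFacts F
  open VectorSpaceFacts F W

  ⊆-refl : ∀ {M} → M ⊆ M
  ⊆-refl x Mx = Mx

  ⊆-trans : ∀ {M M' M''} → M ⊆ M' → M' ⊆ M'' → M ⊆ M''
  ⊆-trans M⊆M' M'⊆M'' x = M'⊆M'' x ∘ M⊆M' x

  scale-mono : ∀ {c M M'} → M ⊆ M' → scale c M ⊆ scale c M'
  scale-mono M⊆M' x (y , My , x≡cy) = y , M⊆M' y My , x≡cy

  scale-∩ : ∀ {c M₁ M₂} → c ≢ 0# → (scale c M₁ ∩ scale c M₂) ⊆ scale c (M₁ ∩ M₂)
  scale-∩ {M₂ = M₂} c≢0 x ((y₁ , M₁y₁ , x≡cy₁) , (y₂ , M₂y₂ , x≡cy₂)) =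
    y₁ , (M₁y₁ , subst M₂ (·-cancelˡ c≢0 (trans (sym x≡cy₂) x≡cy₁)) M₂y₂) , x≡cy₁

  scale-scale : ∀ {c d M} → scale c (scale d M) ⊆ scale (c * d) M
  scale-scale {c} {d} x (y , (z , Mz , y≡dz) , x≡cy) =
    z , Mz , trans x≡cy (trans (cong (c ·_) y≡dz) (sym (·-assoc c d z)))

  scale-scale⁻ : ∀ {c d M} → scale (c * d) M ⊆ scale c (scale d M)
  scale-scale⁻ {c} {d} x (z , Mz , x≡cdz) = d · z , (z , Mz , refl) , trans x≡cdz (·-assoc c d z)

  scale-1 : ∀ {M} → scale 1# M ⊆ M
  scale-1 {M} x (y , My , x≡1y) = subst M (sym (trans x≡1y (·-identity y))) My

  scale-1⁻ : ∀ {M} → M ⊆ scale 1# M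
  scale-1⁻ x Mx = x , Mx , sym (·-identity x)

  ⊆⊇⇒homothetic : ∀ {M M'} → M' ⊆ M → M ⊆ M' → Homothetic M M'
  ⊆⊇⇒homothetic M'⊆M M⊆M' = 1# , 1≢0 , ⊆-trans M'⊆M scale-1⁻ , ⊆-trans scale-1 M⊆M'

  homothetic-scale : ∀ {c M} → c ≢ 0# → Homothetic M (scale c M)
  homothetic-scale c≢0 = _ , c≢0 , ⊆-refl , ⊆-refl

  ClassSet-resp : ∀ {A M M'} → ClassSet A → IsLattice M → M ⊆ M' → M' ⊆ M → A M → A M'
  ClassSet-resp A-class M-lattice M⊆M' M'⊆M = A-class _ _ M-lattice (⊆⊇⇒homothetic M'⊆M M⊆M')

  isLattice-scale : ∀ {c M} → c ≢ 0# → IsLattice M → IsLattice (scale c M)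
  isLattice-scale {c} {M} c≢0 (e , spans , contains , indep) =
    (λ i → c · e i) , spans' , contains' , indep'
    where
    spans' : ∀ x → scale c M x → ∃ λ a → (∀ i → InO (a i)) × x ≡ lc a (λ i → c · e i)
    spans' x (y , My , x≡cy) with spans y My
    ... | a , a-int , refl = a , a-int , trans x≡cy (sym (lc-· c a e))
    contains' : ∀ a → (∀ i → InO (a i)) → scale c M (lc a (λ i → c · e i))
    contains' a a-int = lc a e , contains a a-int , lc-· c a e
    indep' : ∀ a → (∀ i → InO (a i)) → lc a (λ i → c · e i) ≡ 0ᵥ → ∀ i → a i ≡ 0#
    indep' a a-int lc≡0 =
      indep a a-int (·-cancelˡ c≢0 (trans (sym (lc-· c a e)) (trans lc≡0 (sym (·-zeroʳ c)))))

  coords-unique : ∀ {n} {e : Fin n → V} →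
    (∀ a → (∀ i → InO (a i)) → lc a e ≡ 0ᵥ → ∀ i → a i ≡ 0#) →
    ∀ {a b} → (∀ i → InO (a i)) → (∀ i → InO (b i)) → lc a e ≡ lc b e → ∀ i → a i ≡ b i
  coords-unique {e = e} indep {a} {b} a-int b-int lca≡lcb i = begin
    a i        ≡⟨ sub-add-cancel (a i) (b i) ⟨
    d i + b i  ≡⟨ cong (_+ b i) (indep d (λ j → InO-sub (a-int j) (b-int j)) lcd≡0 i) ⟩
    0# + b i   ≡⟨ +-identityˡ (b i) ⟩
    b i        ∎
    where
    open ≡-Reasoning
    d : _ → K
    d j = a j + (- b j)
    lcd≡0 : lc d e ≡ 0ᵥ
    lcd≡0 = ∙-cancelʳ (lc b e) (lc d e) 0ᵥ (begin
      lc d e +ᵥ lc b e         ≡⟨ lc-+ d b e ⟨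
      lc (λ j → d j + b j) e   ≡⟨ lc-cong e (λ j → sub-add-cancel (a j) (b j)) ⟩
      lc a e                   ≡⟨ lca≡lcb ⟩
      lc b e                   ≡⟨ +ᵥ-identityˡ (lc b e) ⟨
      0ᵥ +ᵥ lc b e             ∎)

  -- w ∈ πN iff every coordinate of w in a basis of N has positive valuation.
  π-multiple? : ∀ {N w} → IsLattice N → N w → Dec (scale π N w)
  π-multiple? {N} (e , spans , contains , indep) Nw with spans _ Nw
  ... | a , a-int , refl = map′ divisible⇒multiple multiple⇒divisible (all? λ i → v (a i) ≥∞? (+ 1))
    where
    divisible⇒multiple : (∀ i → v (a i) ≥∞ (+ 1)) → scale π N (lc a e)
    divisible⇒multiple va≥1 =
      lc (λ i → π⁻¹ * a i) e , contains _ (λ i → InO-π⁻¹* (va≥1 i)) ,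
      trans (lc-cong e (λ i → sym (π*π⁻¹* (a i)))) (sym (·-lc π _ e))
    multiple⇒divisible : scale π N (lc a e) → ∀ i → v (a i) ≥∞ (+ 1)
    multiple⇒divisible (y , Ny , lca≡πy) i with spans y Ny
    ... | b , b-int , refl =
      subst (λ x → v x ≥∞ (+ 1))
        (sym (coords-unique indep a-int (λ j → InO-* InO-π (b-int j))
                            (trans lca≡πy (·-lc π b e)) i))
        (v-π* (b-int i))

module MaximalLattice (F : CDVField) (W : FDVS F) (G : Group 0ℓ 0ℓ) (R : Lattices.Rep F W G)
  (S : Lattices.SubV F W → Set) (S-class : Lattices.ClassSet F W S)
  (S-stable : ∀ M → Lattices.IsLattice F W M → S M → Lattices.Rep.Stable R M) where
  open CDVField F
  open Lattices F W
  open Rep R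
  open FieldFacts F using (1≢0; π≢0; *-nonzero)
  open LatticeFacts F W

  module _ {Λ w} (Λ-max : MaximalWrt w Λ) where
    Λ-lattice : IsLattice Λ
    Λ-lattice = proj₁ (proj₁ Λ-max)

    w∈Λ : Λ w
    w∈Λ = proj₁ (proj₁ (proj₂ Λ-max))

    w∉πΛ : ¬ scale π Λ w
    w∉πΛ = proj₂ (proj₁ (proj₂ Λ-max))

    ⊇Λ⇒⊆Λ⊎π-multiple : ∀ {N} → StableLattice N → Λ ⊆ N → N ⊆ Λ ⊎ scale π N w
    ⊇Λ⇒⊆Λ⊎π-multiple N-stable Λ⊆N with π-multiple? (proj₁ N-stable) (Λ⊆N w w∈Λ)
    ... | yes w∈πN = inj₂ w∈πN
    ... | no  w∉πN = inj₁ (proj₂ (proj₂ Λ-max) _ N-stable (Λ⊆N w w∈Λ , w∉πN) Λ⊆N)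

    Dichotomy : SubV → Set
    Dichotomy N = (S N × N ⊆ Λ) ⊎ scale π N w

    Dichotomy-resp : ∀ {N N'} → IsLattice N → N ⊆ N' → N' ⊆ N → Dichotomy N → Dichotomy N'
    Dichotomy-resp N-lattice N⊆N' N'⊆N (inj₁ (SN , N⊆Λ)) =
      inj₁ (ClassSet-resp S-class N-lattice N⊆N' N'⊆N SN , ⊆-trans N'⊆N N⊆Λ)
    Dichotomy-resp _ N⊆N' _ (inj₂ w∈πN) = inj₂ (scale-mono N⊆N' w w∈πN)

    -- Quantifying over scalars rather than over representatives keeps Controlled in Set.
    Controlled : SubV → Set
    Controlled M = ∀ c → c ≢ 0# → Λ ⊆ scale c M → Dichotomy (scale c M)

    S⊆Controlled : ∀ M → IsLattice M → S M → Controlled M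
    S⊆Controlled M M-lattice SM c c≢0 Λ⊆cM =
      map₁ (ScM ,_) (⊇Λ⇒⊆Λ⊎π-multiple (cM-lattice , S-stable _ cM-lattice ScM) Λ⊆cM)
      where
      cM-lattice = isLattice-scale c≢0 M-lattice
      ScM = S-class M (scale c M) M-lattice (homothetic-scale c≢0) SM

    Controlled-class : ClassSet Controlled
    Controlled-class M M' M-lattice (d , d≢0 , M'⊆dM , dM⊆M') M-controlled c c≢0 Λ⊆cM' =
      Dichotomy-resp (isLattice-scale cd≢0 M-lattice) cdM⊆cM' cM'⊆cdM
        (M-controlled (c * d) cd≢0 (⊆-trans Λ⊆cM' cM'⊆cdM))
      where
      cd≢0 = *-nonzero c≢0 d≢0
      cM'⊆cdM : scale c M' ⊆ scale (c * d) M
      cM'⊆cdM = ⊆-trans (scale-mono M'⊆dM) scale-scale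
      cdM⊆cM' : scale (c * d) M ⊆ scale c M'
      cdM⊆cM' = ⊆-trans scale-scale⁻ (scale-mono dM⊆M')

    Controlled-convex : TropicallyConvex Controlled
    Controlled-convex M₁ M₂ M₁-lattice M₂-lattice M₁-controlled M₂-controlled c c≢0 Λ⊆N =
      combine (M₁-controlled c c≢0 (⊆-trans Λ⊆N N⊆cM₁)) (M₂-controlled c c≢0 (⊆-trans Λ⊆N N⊆cM₂))
      where
      N = scale c (M₁ ∩ M₂)
      N⊆cM₁ : N ⊆ scale c M₁
      N⊆cM₁ = scale-mono λ _ → proj₁
      N⊆cM₂ : N ⊆ scale c M₂
      N⊆cM₂ = scale-mono λ _ → proj₂
      squeeze : ∀ {N'} → IsLattice N' → N ⊆ N' → S N' × N' ⊆ Λ → Dichotomy N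
      squeeze N'-lattice N⊆N' (SN' , N'⊆Λ) =
        Dichotomy-resp N'-lattice (⊆-trans N'⊆Λ Λ⊆N) N⊆N' (inj₁ (SN' , N'⊆Λ))
      combine : Dichotomy (scale c M₁) → Dichotomy (scale c M₂) → Dichotomy N
      combine (inj₁ cM₁∈S) _ = squeeze (isLattice-scale c≢0 M₁-lattice) N⊆cM₁ cM₁∈S
      combine _ (inj₁ cM₂∈S) = squeeze (isLattice-scale c≢0 M₂-lattice) N⊆cM₂ cM₂∈S
      combine (inj₂ w∈πcM₁) (inj₂ w∈πcM₂) =
        inj₂ (scale-mono (scale-∩ c≢0) w (scale-∩ π≢0 w (w∈πcM₁ , w∈πcM₂)))

    maximal∈S : InHull S Λ → S Λ
    maximal∈S Λ-in-hull with Dichotomy-resp (isLattice-scale 1≢0 Λ-lattice) scale-1 scale-1⁻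
      (Λ-in-hull Controlled Controlled-class Controlled-convex S⊆Controlled 1# 1≢0 scale-1⁻)
    ... | inj₁ (SΛ , _) = SΛ
    ... | inj₂ w∈πΛ    = ⊥-elim (w∉πΛ w∈πΛ)

proposition4p15 : (F : CDVField) (W : FDVS F) (G : Group 0ℓ 0ℓ) (R : Lattices.Rep F W G) →
    let open Lattices F W in
    let open Rep R in
    (∃ λ Λ → StableLattice Λ) →
    (S : SubV → Set) → ClassSet S →
    (∀ Λ → IsLattice Λ → S Λ → Stable Λ) →
    (∀ Λ → StableLattice Λ → InHull S Λ) →
    (∀ Λ → IsLattice Λ → InHull S Λ → Stable Λ) →
    ∀ Λ → MaximalStable Λ → S Λ
proposition4p15 F W G R _ S S-class S-stable X-in-hull _ Λ (_ , _ , Λ-max) =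
  MaximalLattice.maximal∈S F W G R S S-class S-stable Λ-max (X-in-hull Λ (proj₁ Λ-max))
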